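{- Let $r\ge 2$, $k\ge 2$, $n\ge 1$ and $s$ be integers with $1\le s<r$ and $sn\ge kr$, and let $\mathbf{s}=(s,\ldots,s)\in\mathbb{Z}^n$. Then \[ \chi\Big(\mathrm{KG}^r_{\mathbf{s}}\tbinom{[n]}{k}\Big)\ \le\ 1+\Big\lceil \frac{1}{\lfloor \frac{r-1}{s}\rfloor}\cdot\frac{ns-rk+1}{s}\Big\rceil . \]
   Context: $[n]=\{1,\ldots,n\}$ and $\binom{[n]}{k}$ is the family of all $k$-element subsets of $[n]$. For a vector of multiplicities $\mathbf{s}=(s_1,\ldots,s_n)$, an $r$-tuple of subsets $R_1,\ldots,R_r\subseteq[n]$ is called $\mathbf{s}$-disjoint if each $i\in[n]$ lies in at most $s_i$ of the sets $R_j$. For a hypergraph $\mathcal{S}\subseteq 2^{[n]}$, the $r$-th $\mathbf{s}$-disjoint Kneser hypergraph $\mathrm{KG}^r_{\mathbf{s}}\mathcal{S}$ is the $r$-uniform hypergraph with ground (vertex) set $\mathcal{S}$ whose edges are the $r$-element sets $\{S_1,\ldots,S_r\}\subseteq\mathcal{S}$ that are $\mathbf{s}$-disjoint. A coloring of a hypergraph with ground set $N$ using $m$ colors is a map $c:N\to[m]$ such that no edge is monochromatic; the chromatic number $\chi$ is the least $m$ for which such a coloring exists. -}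

module Defs where

open import Data.Nat using (ℕ; zero; suc; _+_; _*_; _∸_; _/_; _≤_)
open import Data.Fin using (Fin)
open import Data.Fin.Subset using (Subset; ∣_∣; _∈_)
open import Data.Vec using (tabulate; lookup)
open import Data.Product using (Σ; _×_; proj₁)
open import Relation.Binary.PropositionalEquality using (_≡_)
open import Function.Definitions using (Injective)
open import Data.Empty using (⊥)

KSet : ℕ → ℕ → Set
KSet n k = Σ (Subset n) (λ S → ∣ S ∣ ≡ k)

occ : ∀ {n r} → (Fin r → Subset n) → Fin n → ℕ
occ {r = r} R i = ∣ tabulate {n = r} (λ j → lookup (R j) i) ∣

sDisjoint : ∀ {n r} → ℕ → (Fin r → Subset n) → Set
sDisjoint s R = ∀ i → occ R i ≤ s

IsEdge : (n k r s : ℕ) → (Fin r → KSet n k) → Set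
IsEdge n k r s E = Injective _≡_ _≡_ E × sDisjoint s (λ j → proj₁ (E j))

ProperColoring : (n k r s m : ℕ) → (KSet n k → Fin m) → Set
ProperColoring n k r s m c =
  ∀ (E : Fin r → KSet n k) → IsEdge n k r s E →
    Σ (Fin r) (λ j → Σ (Fin r) (λ j' → c (E j) ≡ c (E j') → ⊥))

ChromaticAtMost : (n k r s m : ℕ) → Set
ChromaticAtMost n k r s m = Σ (KSet n k → Fin m) (ProperColoring n k r s m)

-- ceiling division ⌈ a / b ⌉ for b ≥ 1 (value 0 for b = 0, never used below)
ceilDiv : ℕ → ℕ → ℕ
ceilDiv a zero = 0
ceilDiv a (suc b) = (a + b) / suc b

-- floor division ⌊ a / b ⌋ for b ≥ 1 (value 0 for b = 0, never used below)
floorDiv : ℕ → ℕ → ℕ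
floorDiv a zero = 0
floorDiv a (suc b) = a / suc b

{-# OPTIONS --safe #-}
-- Put t = ⌊(r − 1)/s⌋, so that s t < r, and colour a k-set by the block ⌊min S / t⌋ of its
-- least element, merging all blocks from the C-th on into one colour; the C of the bound,
-- ⌈(n s − r k + 1)/(t s)⌉, is chosen so that s (n − C t) < r k.  By double counting, the
-- members of an s-disjoint r-tuple meet a set W of positions at most s ∣W∣ times in total.
-- If the r least elements lie in one block of t positions, this gives r ≤ s t; if all r
-- sets lie beyond position C t, it gives r k ≤ s (n − C t).
module Submission where

open import Defs
open import Data.Nat using (ℕ; _+_; _*_; _∸_; _≤_; _<_)
open import Data.Nat.Base using (zero; suc; z≤n; s≤s; s≤s⁻¹; NonZero; _/_; _%_; _⊓_; >-nonZero)
open import Data.Nat.Properties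
open import Data.Nat.DivMod using (m≡m%n+[m/n]*n; m%n<n; m/n*n≤m; m≥n⇒m/n>0)
open import Data.Bool using (Bool; true; false; _∧_)
open import Data.Fin using (Fin; zero; suc; toℕ; fromℕ<)
open import Data.Fin.Properties using (toℕ-fromℕ<; toℕ<n; ¬∀⟶∃¬; all?) renaming (_≟_ to _≟ᶠ_)
open import Data.Fin.Subset using (Subset; ∣_∣; _∈_; _⊆_; _∩_; Nonempty; ⊥; inside; outside)
open import Data.Fin.Subset.Properties using (∣⊥∣≡0; ∣p∣≤n; ∣p∣≤∣x∷p∣; x∈p∩q⁺; p⊆q⇒∣p∣≤∣q∣)
open import Data.Vec using ([]; _∷_; here; there; lookup; tabulate)
open import Data.Vec.Properties using (lookup∘tabulate; lookup-zipWith)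
open import Data.Product using (∃; Σ; _×_; _,_; proj₁; proj₂)
open import Data.Sum using (inj₁; inj₂)
open import Function using (_∘_)
open import Relation.Nullary using (¬_; yes; no; contradiction)
open import Relation.Binary.PropositionalEquality using (_≡_; _≢_; refl; sym; trans; cong; cong₂; subst)
open import Algebra.Properties.Semiring.Sum +-*-semiring
  using (sum; sum-syntax; sum-cong-≗; ∑-comm; *-distribˡ-sum; *-distribʳ-sum)

sum-mono-≤ : ∀ {n} {f g : Fin n → ℕ} → (∀ i → f i ≤ g i) → sum f ≤ sum g
sum-mono-≤ {zero}  _   = z≤n
sum-mono-≤ {suc n} f≤g = +-mono-≤ (f≤g zero) (sum-mono-≤ (f≤g ∘ suc))

*≤sum : ∀ {n c} {f : Fin n → ℕ} → (∀ i → c ≤ f i) → n * c ≤ sum f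
*≤sum {zero}  _   = z≤n
*≤sum {suc n} c≤f = +-mono-≤ (c≤f zero) (*≤sum (c≤f ∘ suc))

𝟙 : Bool → ℕ
𝟙 true  = 1
𝟙 false = 0

𝟙-∧ : ∀ a b → 𝟙 (a ∧ b) ≡ 𝟙 a * 𝟙 b
𝟙-∧ true  b = sym (+-identityʳ (𝟙 b))
𝟙-∧ false b = refl

∣p∣≡∑𝟙 : ∀ {n} (p : Subset n) → ∣ p ∣ ≡ ∑[ i < n ] 𝟙 (lookup p i)
∣p∣≡∑𝟙 []            = refl
∣p∣≡∑𝟙 (true  ∷ p) = cong suc (∣p∣≡∑𝟙 p)
∣p∣≡∑𝟙 (false ∷ p) = ∣p∣≡∑𝟙 p

∣p∩q∣≡∑𝟙*𝟙 : ∀ {n} (p q : Subset n) → ∣ p ∩ q ∣ ≡ ∑[ i < n ] (𝟙 (lookup p i) * 𝟙 (lookup q i))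
∣p∩q∣≡∑𝟙*𝟙 p q = trans (∣p∣≡∑𝟙 (p ∩ q))
  (sum-cong-≗ (λ i → trans (cong 𝟙 (lookup-zipWith _∧_ i p q)) (𝟙-∧ (lookup p i) (lookup q i))))

occ≡∑𝟙 : ∀ {n r} (R : Fin r → Subset n) i → occ R i ≡ ∑[ j < r ] 𝟙 (lookup (R j) i)
occ≡∑𝟙 {r = r} R i = trans (∣p∣≡∑𝟙 (tabulate R∋i)) (sum-cong-≗ (cong 𝟙 ∘ lookup∘tabulate R∋i))
  where
  R∋i : Fin r → Bool
  R∋i j = lookup (R j) i

∈⇒0<∣p∣ : ∀ {n} {p : Subset n} {x} → x ∈ p → 0 < ∣ p ∣
∈⇒0<∣p∣ here        = s≤s z≤n
∈⇒0<∣p∣ {p = y ∷ p} (there x∈p) = <-≤-trans (∈⇒0<∣p∣ x∈p) (∣p∣≤∣x∷p∣ y p)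

interval : ∀ {n} → ℕ → ℕ → Subset n
interval {zero}  _       _       = []
interval {suc n} zero    zero    = ⊥
interval {suc n} zero    (suc w) = inside ∷ interval zero w
interval {suc n} (suc l) w       = outside ∷ interval l w

∣interval∣≤w : ∀ {n} l w → ∣ interval {n} l w ∣ ≤ w
∣interval∣≤w {zero}  _       _       = z≤n
∣interval∣≤w {suc n} zero    zero    = ≤-reflexive (∣⊥∣≡0 (suc n))
∣interval∣≤w {suc n} zero    (suc w) = s≤s (∣interval∣≤w {n} zero w)
∣interval∣≤w {suc n} (suc l) w       = ∣interval∣≤w {n} l w

∣interval∣≤n∸l : ∀ {n} l w → ∣ interval {n} l w ∣ ≤ n ∸ l
∣interval∣≤n∸l {zero}  _       _ = z≤n
∣interval∣≤n∸l {suc n} zero    w = ∣p∣≤n (interval zero w)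
∣interval∣≤n∸l {suc n} (suc l) w = ∣interval∣≤n∸l {n} l w

∈-interval : ∀ {n} {i : Fin n} l w → l ≤ toℕ i → toℕ i < l + w → i ∈ interval l w
∈-interval {i = zero}  zero    (suc w) _         _           = here
∈-interval {i = suc i} zero    (suc w) _         (s≤s i<w)   = there (∈-interval zero w z≤n i<w)
∈-interval {i = suc i} (suc l) w       (s≤s l≤i) (s≤s i<l+w) = there (∈-interval l w l≤i i<l+w)

-- Position of the least element of p, or n when p is empty.
first : ∀ {n} → Subset n → ℕ
first []            = 0
first (inside  ∷ p) = 0
first (outside ∷ p) = suc (first p)

first-minimal : ∀ {n} {p : Subset n} {i} → i ∈ p → first p ≤ toℕ i
first-minimal {p = inside  ∷ p} _           = z≤n
first-minimal {p = outside ∷ p} (there i∈p) = s≤s (first-minimal i∈p)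

first-∈ : ∀ {n} (p : Subset n) → 0 < ∣ p ∣ → ∃ λ i → toℕ i ≡ first p × i ∈ p
first-∈ (inside  ∷ p) _   = zero , refl , here
first-∈ (outside ∷ p) 0<∣p∣ with first-∈ p 0<∣p∣
... | i , i≡first , i∈p = suc i , cong suc i≡first , there i∈p

m<[m/n]*n+n : ∀ m n .{{_ : NonZero n}} → m < m / n * n + n
m<[m/n]*n+n m n = begin-strict
  m                  ≡⟨ m≡m%n+[m/n]*n m n ⟩
  m % n + m / n * n  <⟨ +-monoˡ-< (m / n * n) (m%n<n m n) ⟩
  n + m / n * n      ≡⟨ +-comm n (m / n * n) ⟩
  m / n * n + n      ∎
  where open ≤-Reasoning

m/n≡q⇒q*n≤m<q*n+n : ∀ {m n q} .{{_ : NonZero n}} → m / n ≡ q → q * n ≤ m × m < q * n + n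
m/n≡q⇒q*n≤m<q*n+n {m} {n} refl = m/n*n≤m m n , m<[m/n]*n+n m n

module _ {n r s : ℕ} {R : Fin r → Subset n} (disj : sDisjoint s R) where

  sDisjoint⇒∑∣R∩W∣≤s*∣W∣ : ∀ W → ∑[ j < r ] ∣ R j ∩ W ∣ ≤ s * ∣ W ∣
  sDisjoint⇒∑∣R∩W∣≤s*∣W∣ W = begin
    ∑[ j < r ] ∣ R j ∩ W ∣
      ≡⟨ sum-cong-≗ (λ j → ∣p∩q∣≡∑𝟙*𝟙 (R j) W) ⟩
    ∑[ j < r ] ∑[ i < n ] (𝟙 (R∋ j i) * 𝟙 (W∋ i))
      ≡⟨ ∑-comm (λ j i → 𝟙 (R∋ j i) * 𝟙 (W∋ i)) ⟩
    ∑[ i < n ] ∑[ j < r ] (𝟙 (R∋ j i) * 𝟙 (W∋ i))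
      ≡⟨ sum-cong-≗ (λ i → sym (*-distribʳ-sum (𝟙 (W∋ i)) (λ j → 𝟙 (R∋ j i)))) ⟩
    ∑[ i < n ] ((∑[ j < r ] 𝟙 (R∋ j i)) * 𝟙 (W∋ i))
      ≡⟨ sum-cong-≗ (λ i → cong (_* 𝟙 (W∋ i)) (sym (occ≡∑𝟙 R i))) ⟩
    ∑[ i < n ] (occ R i * 𝟙 (W∋ i))
      ≤⟨ sum-mono-≤ (λ i → *-monoˡ-≤ (𝟙 (W∋ i)) (disj i)) ⟩
    ∑[ i < n ] (s * 𝟙 (W∋ i))
      ≡⟨ *-distribˡ-sum s (λ i → 𝟙 (W∋ i)) ⟨
    s * ∑[ i < n ] 𝟙 (W∋ i)
      ≡⟨ cong (s *_) (∣p∣≡∑𝟙 W) ⟨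
    s * ∣ W ∣
      ∎
    where
    open ≤-Reasoning
    R∋ : Fin r → Fin n → Bool
    R∋ j = lookup (R j)
    W∋ : Fin n → Bool
    W∋ = lookup W

  meetAll⇒r≤s*∣W∣ : ∀ W → (∀ j → Nonempty (R j ∩ W)) → r ≤ s * ∣ W ∣
  meetAll⇒r≤s*∣W∣ W meet = begin
    r                      ≡⟨ sym (*-identityʳ r) ⟩
    r * 1                  ≤⟨ *≤sum (λ j → ∈⇒0<∣p∣ (proj₂ (meet j))) ⟩
    ∑[ j < r ] ∣ R j ∩ W ∣ ≤⟨ sDisjoint⇒∑∣R∩W∣≤s*∣W∣ W ⟩
    s * ∣ W ∣              ∎
    where open ≤-Reasoning

  allInside⇒r*k≤s*∣W∣ : ∀ {k} W → (∀ j → ∣ R j ∣ ≡ k) → (∀ j → R j ⊆ W) → r * k ≤ s * ∣ W ∣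
  allInside⇒r*k≤s*∣W∣ {k} W size R⊆W = begin
    r * k                  ≤⟨ *≤sum (λ j → subst (_≤ ∣ R j ∩ W ∣) (size j) (∣R∣≤∣R∩W∣ j)) ⟩
    ∑[ j < r ] ∣ R j ∩ W ∣ ≤⟨ sDisjoint⇒∑∣R∩W∣≤s*∣W∣ W ⟩
    s * ∣ W ∣              ∎
    where
    open ≤-Reasoning
    ∣R∣≤∣R∩W∣ : ∀ j → ∣ R j ∣ ≤ ∣ R j ∩ W ∣
    ∣R∣≤∣R∩W∣ j = p⊆q⇒∣p∣≤∣q∣ (λ x∈R → x∈p∩q⁺ (x∈R , R⊆W j x∈R))

  sameBlock⇒r≤s*t : ∀ t c .{{_ : NonZero t}} →
    (∀ j → 0 < ∣ R j ∣) → (∀ j → first (R j) / t ≡ c) → r ≤ s * t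
  sameBlock⇒r≤s*t t c nonempty inBlock = begin
    r              ≤⟨ meetAll⇒r≤s*∣W∣ block meet ⟩
    s * ∣ block ∣  ≤⟨ *-monoʳ-≤ s (∣interval∣≤w {n} (c * t) t) ⟩
    s * t          ∎
    where
    open ≤-Reasoning
    block : Subset n
    block = interval (c * t) t
    meet : ∀ j → Nonempty (R j ∩ block)
    meet j with first-∈ (R j) (nonempty j) | m/n≡q⇒q*n≤m<q*n+n (inBlock j)
    ... | i , i≡first , i∈R | lower , upper =
      i , x∈p∩q⁺ (i∈R , ∈-interval (c * t) t (subst (c * t ≤_) (sym i≡first) lower)
                                             (subst (_< c * t + t) (sym i≡first) upper))

  beyond⇒r*k≤s*[n∸l] : ∀ {k} l → (∀ j → ∣ R j ∣ ≡ k) → (∀ j → l ≤ first (R j)) → r * k ≤ s * (n ∸ l)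
  beyond⇒r*k≤s*[n∸l] {k} l size l≤first = begin
    r * k         ≤⟨ allInside⇒r*k≤s*∣W∣ tail size R⊆tail ⟩
    s * ∣ tail ∣  ≤⟨ *-monoʳ-≤ s (∣interval∣≤n∸l {n} l n) ⟩
    s * (n ∸ l)   ∎
    where
    open ≤-Reasoning
    tail : Subset n
    tail = interval l n
    R⊆tail : ∀ j → R j ⊆ tail
    R⊆tail j {i} i∈R = ∈-interval l n (≤-trans (l≤first j) (first-minimal i∈R))
                                      (<-≤-trans (toℕ<n i) (m≤n+m n l))

nonconstant⇒∃≢ : ∀ {r m} (f : Fin r → Fin m) → ¬ (∀ j j′ → f j ≡ f j′) →
  Σ (Fin r) λ j → Σ (Fin r) λ j′ → f j ≢ f j′
nonconstant⇒∃≢ {r} f nonconstant with ¬∀⟶∃¬ r _ (λ j → all? (λ j′ → f j ≟ᶠ f j′)) nonconstant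
... | j , ¬∀j′ = j , ¬∀⟶∃¬ r _ (λ j′ → f j ≟ᶠ f j′) ¬∀j′

m⊓n≡o<m⇒n≡o : ∀ {m n o} → m ⊓ n ≡ o → o < m → n ≡ o
m⊓n≡o<m⇒n≡o {m} {n} m⊓n≡o o<m with ⊓-sel m n
... | inj₁ m⊓n≡m = contradiction (trans (sym m⊓n≡m) m⊓n≡o) (>⇒≢ o<m)
... | inj₂ m⊓n≡n = trans (sym m⊓n≡n) m⊓n≡o

module BlockColouring (n k r s t C : ℕ) .{{_ : NonZero t}}
  (0<k : 0 < k) (s*t<r : s * t < r) (s*[n∸C*t]<r*k : s * (n ∸ C * t) < r * k) where

  block : KSet n k → ℕ
  block (S , _) = first S / t

  colour : KSet n k → Fin (suc C)
  colour S = fromℕ< (s≤s (m⊓n≤m C (block S)))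

  module _ (E : Fin r → KSet n k) (disj : sDisjoint s (proj₁ ∘ E)) (c : ℕ) where

    ¬sameColour<C : c < C → ¬ (∀ j → C ⊓ block (E j) ≡ c)
    ¬sameColour<C c<C mono = <⇒≱ s*t<r
      (sameBlock⇒r≤s*t disj t c nonempty (λ j → m⊓n≡o<m⇒n≡o (mono j) c<C))
      where
      nonempty : ∀ j → 0 < ∣ proj₁ (E j) ∣
      nonempty j = subst (0 <_) (sym (proj₂ (E j))) 0<k

    ¬sameColour≥C : C ≤ c → ¬ (∀ j → C ⊓ block (E j) ≡ c)
    ¬sameColour≥C C≤c mono = <⇒≱ s*[n∸C*t]<r*k
      (beyond⇒r*k≤s*[n∸l] disj (C * t) (proj₂ ∘ E) (λ j → ≤-trans (*-monoˡ-≤ t (C≤block j)) (m/n*n≤m _ t)))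
      where
      C≤block : ∀ j → C ≤ block (E j)
      C≤block j = ≤-trans C≤c (≤-trans (≤-reflexive (sym (mono j))) (m⊓n≤n C _))

    ¬sameColour : ¬ (∀ j → C ⊓ block (E j) ≡ c)
    ¬sameColour with c <? C
    ... | yes c<C = ¬sameColour<C c<C
    ... | no c≮C  = ¬sameColour≥C (≮⇒≥ c≮C)

  noMonochromaticEdge : (E : Fin r → KSet n k) → sDisjoint s (proj₁ ∘ E) →
    ∀ c → ¬ (∀ j → colour (E j) ≡ c)
  noMonochromaticEdge E disj c mono =
    ¬sameColour E disj (toℕ c) (λ j → trans (sym (toℕ-fromℕ< _)) (cong toℕ (mono j)))

  properColouring : ProperColoring n k r s (suc C) colour
  properColouring E (_ , disj) = nonconstant⇒∃≢ (colour ∘ E)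
    (λ constant → noMonochromaticEdge E disj (colour (E j₀)) (λ j → constant j j₀))
    where
    j₀ : Fin r
    j₀ = fromℕ< (≤-<-trans z≤n s*t<r)

m≤⌈m/n⌉*n : ∀ m n .{{_ : NonZero n}} → m ≤ ceilDiv m n * n
m≤⌈m/n⌉*n m (suc d) = +-cancelʳ-≤ d m (q * suc d)
  (s≤s⁻¹ (subst (m + d <_) (+-suc (q * suc d) d) (m<[m/n]*n+n (m + d) (suc d))))
  where
  q : ℕ
  q = ceilDiv m (suc d)

m∸[m∸n+1]<n : ∀ m n .{{_ : NonZero n}} → m ∸ (m ∸ n + 1) < n
m∸[m∸n+1]<n m n = m<n+o⇒m∸n<o m (m ∸ n + 1) (begin-strict
  m                 ≤⟨ m≤n+m∸n m n ⟩
  n + (m ∸ n)       <⟨ n<1+n _ ⟩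
  suc (n + (m ∸ n)) ≡⟨ cong suc (+-comm n (m ∸ n)) ⟩
  suc (m ∸ n + n)   ≡⟨ +-suc (m ∸ n) n ⟨
  m ∸ n + suc n     ≡⟨ +-assoc (m ∸ n) 1 n ⟨
  m ∸ n + 1 + n     ∎)
  where open ≤-Reasoning

lemma3p1 : (r k n s : ℕ) → 2 ≤ r → 2 ≤ k → 1 ≤ n → 1 ≤ s → s < r → k * r ≤ s * n →
    ChromaticAtMost n k r s (1 + ceilDiv (n * s ∸ r * k + 1) (floorDiv (r ∸ 1) s * s))
lemma3p1 r k n s@(suc _) _ 2≤k _ _ (s≤s s≤r∸1) _ = colour , properColouring
  where
  t C : ℕ
  t = (r ∸ 1) / s
  C = ceilDiv (n * s ∸ r * k + 1) (t * s)
  0<k : 0 < k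
  0<k = ≤-trans (s≤s z≤n) 2≤k
  instance
    t≢0 : NonZero t
    t≢0 = >-nonZero (m≥n⇒m/n>0 s≤r∸1)
    k≢0 : NonZero k
    k≢0 = >-nonZero 0<k
  open ≤-Reasoning
  s*t<r : s * t < r
  s*t<r = begin-strict
    s * t  ≡⟨ *-comm s t ⟩
    t * s  ≤⟨ m/n*n≤m (r ∸ 1) s ⟩
    r ∸ 1  <⟨ n<1+n (r ∸ 1) ⟩
    r      ∎
  s*[n∸C*t]<r*k : s * (n ∸ C * t) < r * k
  s*[n∸C*t]<r*k = begin-strict
    s * (n ∸ C * t)               ≡⟨ *-distribˡ-∸ s n (C * t) ⟩
    s * n ∸ s * (C * t)           ≡⟨ cong₂ _∸_ (*-comm s n) (trans (*-comm s (C * t)) (*-assoc C t s)) ⟩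
    n * s ∸ C * (t * s)           ≤⟨ ∸-monoʳ-≤ (n * s) (m≤⌈m/n⌉*n (n * s ∸ r * k + 1) (t * s) {{m*n≢0 t s}}) ⟩
    n * s ∸ (n * s ∸ r * k + 1)   <⟨ m∸[m∸n+1]<n (n * s) (r * k) {{m*n≢0 r k}} ⟩
    r * k                         ∎
  open BlockColouring n k r s t C 0<k s*t<r s*[n∸C*t]<r*k
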